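{- Let $h,k\in\{0,1,2\}$ with $h+k\ge1$. For every positive integer $n$, the number of ways to place two unlabelled nonattacking partial queens $\mathsf{Q}^{hk}$ on the $n\times n$ board is $$u_{\mathsf{Q}^{hk}}(2;n)=\frac12n^4-\frac{3h+2k}{6}n^3+\frac{h+k-1}{2}n^2-\frac k6n.$$
   Context: The board is $[n]^2$ with $[n]=\{1,\dots,n\}$. A partial queen $\mathsf{Q}^{hk}$ has basic move set consisting of $h$ vectors from $\{(1,0),(0,1)\}$ and $k$ vectors from $\{(1,1),(1,-1)\}$. A piece at $z_i$ attacks a piece at $z_j$ if $z_j-z_i$ is a multiple of some basic move (so two pieces on the same square attack each other). $u_{\mathsf{Q}^{hk}}(q;n)$ is the number of placements of $q$ unlabelled pairwise nonattacking pieces on $[n]^2$. -}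

module Defs where

open import Data.Bool using (Bool; true; false; _∨_; if_then_else_)
open import Data.Nat as ℕ using (ℕ; zero; suc)
open import Data.Integer as ℤ using (ℤ; +_; _-_)
open import Data.Product using (_×_; _,_)
open import Data.List using (List; []; _∷_; map; _++_; filterᵇ; length; concatMap; upTo)
open import Relation.Nullary.Decidable using (⌊_⌋)

Square : Set
Square = ℤ × ℤ

range : ℕ → List ℤ
range n = map (λ i → + (suc i)) (upTo n)

board : ℕ → List Square
board n = concatMap (λ x → map (λ y → (x , y)) (range n)) (range n)

-- All unordered pairs {a,b} of distinct positions of a list (each 2-subset once).
pairs : {A : Set} → List A → List (A × A)
pairs []       = []
pairs (x ∷ xs) = map (λ y → (x , y)) xs ++ pairs xs

-- The partial queen: which basic moves it has.
-- hz = (1,0), vt = (0,1), dg = (1,1), ad = (1,-1).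
record Piece : Set where
  constructor piece
  field
    hz vt dg ad : Bool

b2n : Bool → ℕ
b2n true  = 1
b2n false = 0

-- h = number of basic moves from {(1,0),(0,1)}, k = number from {(1,1),(1,-1)}.
hOf : Piece → ℕ
hOf (piece a b _ _) = b2n a ℕ.+ b2n b

kOf : Piece → ℕ
kOf (piece _ _ c d) = b2n c ℕ.+ b2n d

eqℤ : ℤ → ℤ → Bool
eqℤ a b = ⌊ a ℤ.≟ b ⌋

-- d = (dx,dy) is an integer multiple of the basic move v:
--   multiple of (1,0)  ⇔ dy = 0
--   multiple of (0,1)  ⇔ dx = 0
--   multiple of (1,1)  ⇔ dx = dy
--   multiple of (1,-1) ⇔ dx = -dy
-- A piece at z attacks a piece at w iff w - z is a multiple of some basic move.
attacks : Piece → Square → Square → Bool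
attacks (piece a b c d) (x₁ , y₁) (x₂ , y₂) =
  let dx = x₂ - x₁ ; dy = y₂ - y₁ in
     (if a then eqℤ dy (+ 0) else false)
   ∨ (if b then eqℤ dx (+ 0) else false)
   ∨ (if c then eqℤ dx dy else false)
   ∨ (if d then eqℤ dx (ℤ.- dy) else false)

nonattacking : Piece → Square × Square → Bool
nonattacking P (z , w) = if attacks P z w then false else (if attacks P w z then false else true)

-- u_P(2;n): number of placements of two unlabelled pairwise nonattacking pieces P
-- on [n]^2 (unordered pairs of squares; two pieces on one square attack each other,
-- so only pairs of distinct squares can occur).
u2 : Piece → ℕ → ℕ
u2 P n = length (filterᵇ (nonattacking P) (pairs (board n)))

module Submission where

-- Index the board by 0-based coordinates (i,j) ∈ [0,n)².  Since attacking is
-- symmetric and every square attacks itself, 2·u(2;n) = n⁴ − A, where A is the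
-- number of ordered pairs of squares (z,w) with w on one of the piece's lines
-- through z.  Two distinct squares lie on at most one common line, while a
-- square lies on all of them; hence, summed over ordered pairs,
--   A + (h+k)·n² = h·n³ + k·D + n²,
-- since a row or a column contains n³ ordered pairs, the diagonals contain D of
-- them, the anti-diagonals too (reflect the board), and n² pairs have z = w.
-- Finally D = Σ_{i,j} (n − |i−j|) and Σ_{i,j} |i−j| = (n³−n)/3 give 3D = 2n³ + n.

open import Defs
open import Data.Nat using (ℕ; _≤_)
open import Data.Nat as ℕ using ()
open import Relation.Binary.PropositionalEquality using (_≡_)

open import Data.Bool using (Bool; true; false; _∧_; _∨_; if_then_else_)
open import Data.Product using (_×_; _,_; proj₁; proj₂)
open import Relation.Binary.PropositionalEquality
  using (refl; sym; trans; cong; cong₂; module ≡-Reasoning)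

-- Equalities between differences in ℤ, cleared of subtraction: the attack test
-- compares coordinate differences, the counting works with sums of naturals.
module Differences where

  open import Data.Integer using (ℤ; _+_; _-_; -_)
  open import Data.Integer.Solver using (module +-*-Solver)
  open +-*-Solver using (solve; _:+_; _:-_; :-_; _:=_)
  open ≡-Reasoning

  sub-≡-sub : ∀ (x y u v : ℤ) → (x - y ≡ u - v → x + v ≡ u + y) × (x + v ≡ u + y → x - y ≡ u - v)
  sub-≡-sub x y u v = to , from
    where
    to : x - y ≡ u - v → x + v ≡ u + y
    to e = begin
      x + v             ≡⟨ solve 3 (λ x y v → x :+ v := (x :- y) :+ (y :+ v)) refl x y v ⟩
      (x - y) + (y + v) ≡⟨ cong (_+ (y + v)) e ⟩
      (u - v) + (y + v) ≡⟨ solve 3 (λ u v y → (u :- v) :+ (y :+ v) := u :+ y) refl u v y ⟩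
      u + y             ∎
    from : x + v ≡ u + y → x - y ≡ u - v
    from e = begin
      x - y             ≡⟨ solve 3 (λ x y v → x :- y := (x :+ v) :- (y :+ v)) refl x y v ⟩
      (x + v) - (y + v) ≡⟨ cong (_- (y + v)) e ⟩
      (u + y) - (y + v) ≡⟨ solve 3 (λ u v y → (u :+ y) :- (y :+ v) := u :- v) refl u v y ⟩
      u - v             ∎

  sub-≡-neg-sub : ∀ (x y u v : ℤ) → (x - y ≡ - (u - v) → x + u ≡ y + v) × (x + u ≡ y + v → x - y ≡ - (u - v))
  sub-≡-neg-sub x y u v = to , from
    where
    to : x - y ≡ - (u - v) → x + u ≡ y + v
    to e = begin
      x + u               ≡⟨ solve 3 (λ x y u → x :+ u := (x :- y) :+ (y :+ u)) refl x y u ⟩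
      (x - y) + (y + u)   ≡⟨ cong (_+ (y + u)) e ⟩
      - (u - v) + (y + u) ≡⟨ solve 3 (λ u v y → (:- (u :- v)) :+ (y :+ u) := y :+ v) refl u v y ⟩
      y + v               ∎
    from : x + u ≡ y + v → x - y ≡ - (u - v)
    from e = begin
      x - y               ≡⟨ solve 3 (λ x y u → x :- y := (x :+ u) :- (y :+ u)) refl x y u ⟩
      (x + u) - (y + u)   ≡⟨ cong (_- (y + u)) e ⟩
      (y + v) - (y + u)   ≡⟨ solve 3 (λ u v y → (y :+ v) :- (y :+ u) := :- (u :- v)) refl u v y ⟩
      - (u - v)           ∎

module Counting where

  open import Data.Nat
    using (zero; suc; _+_; _*_; _^_; _∸_; _<_; _≟_; _<?_; _≤?_; s≤s; ∣_-_∣)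
  open import Data.Nat.Properties
    using ( +-comm; +-assoc; +-suc; +-identityʳ; *-zeroʳ; *-identityʳ; *-comm
          ; *-distribˡ-+; *-distribʳ-+; +-cancelʳ-≡; +-cancelˡ-≡; *-cancelˡ-≡
          ; suc-injective; ≤-refl; ≤-trans; ≤-pred; <⇒≤; ≰⇒>; <-cmp; <-irrefl
          ; m<n⇒m<1+n; m≤n+m; m∸n+n≡m; +-∸-assoc; m≤n⇒m∸n≡0; n∸n≡0; 0∸n≡0
          ; ≤-total; m≤n⇒∃[o]m+o≡n; ∣m-m+n∣≡n; ∣-∣-comm; ∣n-n∣≡0 )
  open import Data.Nat.Solver using (module +-*-Solver)
  open +-*-Solver using (solve; _:+_; _:*_; _:=_; con)
  open import Data.Sum using (inj₁; inj₂)
  open import Relation.Nullary using (Dec; yes; no; ¬_)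
  open import Relation.Nullary.Decidable
    using (⌊_⌋; isYes≗does; dec-true; dec-false; does-⇔)
  open import Relation.Nullary.Negation using (contradiction)
  open import Relation.Binary using (tri<; tri≈; tri>)
  open import Function.Bundles using (mk⇔)
  open import Data.List using (List; []; _∷_; map; _++_; concat; applyUpTo; upTo; length; filterᵇ)
  open import Data.Integer as ℤ using (ℤ; +0; +[1+_])
  import Data.Integer.Properties as ℤP
  open import Data.Bool.Properties using (∧-identityʳ; ∧-zeroʳ)
  open Differences
  open ≡-Reasoning

  ⌊⌋-true : ∀ {a} {A : Set a} (a? : Dec A) → A → ⌊ a? ⌋ ≡ true
  ⌊⌋-true a? a = trans (isYes≗does a?) (dec-true a? a)

  ⌊⌋-false : ∀ {a} {A : Set a} (a? : Dec A) → ¬ A → ⌊ a? ⌋ ≡ false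
  ⌊⌋-false a? ¬a = trans (isYes≗does a?) (dec-false a? ¬a)

  ⌊⌋-⇔ : ∀ {a b} {A : Set a} {B : Set b} (a? : Dec A) (b? : Dec B) →
         (A → B) → (B → A) → ⌊ a? ⌋ ≡ ⌊ b? ⌋
  ⌊⌋-⇔ a? b? to from =
    trans (isYes≗does a?) (trans (does-⇔ (mk⇔ to from) a? b?) (sym (isYes≗does b?)))

  δ : ℕ → ℕ → ℕ
  δ x y = b2n ⌊ x ≟ y ⌋

  b2n-∧ : ∀ x y → b2n (x ∧ y) ≡ b2n y * b2n x
  b2n-∧ true  true  = refl
  b2n-∧ true  false = refl
  b2n-∧ false true  = refl
  b2n-∧ false false = refl

  ∑ : (ℕ → ℕ) → ℕ → ℕ
  ∑ f zero    = 0
  ∑ f (suc n) = ∑ f n + f n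

  ∑-cong : ∀ {f g} n → (∀ i → i < n → f i ≡ g i) → ∑ f n ≡ ∑ g n
  ∑-cong zero    eq = refl
  ∑-cong (suc n) eq = cong₂ _+_ (∑-cong n (λ i i<n → eq i (m<n⇒m<1+n i<n))) (eq n ≤-refl)

  ∑-+ : ∀ f g n → ∑ (λ i → f i + g i) n ≡ ∑ f n + ∑ g n
  ∑-+ f g zero    = refl
  ∑-+ f g (suc n) = begin
      ∑ (λ i → f i + g i) n + (f n + g n)
    ≡⟨ cong (_+ (f n + g n)) (∑-+ f g n) ⟩
      (∑ f n + ∑ g n) + (f n + g n)
    ≡⟨ solve 4 (λ a b c d → (a :+ b) :+ (c :+ d) := (a :+ c) :+ (b :+ d)) refl (∑ f n) (∑ g n) (f n) (g n) ⟩
      (∑ f n + f n) + (∑ g n + g n) ∎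

  ∑-* : ∀ c f n → ∑ (λ i → c * f i) n ≡ c * ∑ f n
  ∑-* c f zero    = sym (*-zeroʳ c)
  ∑-* c f (suc n) = trans (cong (_+ c * f n) (∑-* c f n)) (sym (*-distribˡ-+ c (∑ f n) (f n)))

  ∑-const : ∀ c n → ∑ (λ _ → c) n ≡ n * c
  ∑-const c zero    = refl
  ∑-const c (suc n) = trans (cong (_+ c) (∑-const c n)) (+-comm (n * c) c)

  ∑-head : ∀ f n → ∑ f (suc n) ≡ f 0 + ∑ (λ i → f (suc i)) n
  ∑-head f zero    = +-comm 0 (f 0)
  ∑-head f (suc n) = trans (cong (_+ f (suc n)) (∑-head f n)) (+-assoc (f 0) _ _)

  ∑-swap : ∀ (f : ℕ → ℕ → ℕ) m n → ∑ (λ a → ∑ (λ b → f a b) m) n ≡ ∑ (λ b → ∑ (λ a → f a b) n) m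
  ∑-swap f m zero    = sym (trans (∑-const 0 m) (*-zeroʳ m))
  ∑-swap f m (suc n) = trans (cong (_+ ∑ (f n) m) (∑-swap f m n)) (sym (∑-+ (λ b → ∑ (λ a → f a b) n) (f n) m))

  ∑-reverse : ∀ f n → ∑ f n ≡ ∑ (λ i → f (n ∸ suc i)) n
  ∑-reverse f zero    = refl
  ∑-reverse f (suc n) = begin
      ∑ f (suc n)
    ≡⟨ ∑-head f n ⟩
      f 0 + ∑ (λ i → f (suc i)) n
    ≡⟨ cong (f 0 +_) (∑-reverse (λ i → f (suc i)) n) ⟩
      f 0 + ∑ (λ i → f (suc (n ∸ suc i))) n
    ≡⟨ cong₂ _+_ (cong f (sym (n∸n≡0 n))) (∑-cong n (λ i i<n → cong f (sym (+-∸-assoc 1 i<n)))) ⟩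
      f (n ∸ n) + ∑ (λ i → f (n ∸ i)) n
    ≡⟨ +-comm (f (n ∸ n)) _ ⟩
      ∑ (λ i → f (suc n ∸ suc i)) (suc n) ∎

  ∑-δ : ∀ c n → ∑ (λ b → δ b c) n ≡ b2n ⌊ c <? n ⌋
  ∑-δ c zero    = refl
  ∑-δ c (suc n) = trans (cong (_+ δ n c) (∑-δ c n)) (last c n)
    where
    last : ∀ c n → b2n ⌊ c <? n ⌋ + δ n c ≡ b2n ⌊ c <? suc n ⌋
    last c n with <-cmp c n
    ... | tri< c<n c≢n _
      rewrite ⌊⌋-true (c <? n) c<n | ⌊⌋-false (n ≟ c) (λ e → c≢n (sym e))
            | ⌊⌋-true (c <? suc n) (m<n⇒m<1+n c<n) = refl
    ... | tri≈ c≮n refl _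
      rewrite ⌊⌋-false (c <? c) c≮n | ⌊⌋-true (c ≟ c) refl | ⌊⌋-true (c <? suc c) ≤-refl = refl
    ... | tri> c≮n c≢n n<c
      rewrite ⌊⌋-false (c <? n) c≮n | ⌊⌋-false (n ≟ c) (λ e → c≢n (sym e))
            | ⌊⌋-false (c <? suc n) (λ c<1+n → <-irrefl refl (≤-trans (s≤s n<c) c<1+n)) = refl

  ∑-δ-below : ∀ {c n} → c < n → ∑ (λ b → δ b c) n ≡ 1
  ∑-δ-below {c} {n} c<n = trans (∑-δ c n) (cong b2n (⌊⌋-true (c <? n) c<n))

  ∑□ : (ℕ → ℕ → ℕ) → ℕ → ℕ
  ∑□ f n = ∑ (λ i → ∑ (λ j → f i j) n) n

  ∑□□ : (ℕ → ℕ → ℕ → ℕ → ℕ) → ℕ → ℕ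
  ∑□□ f n = ∑□ (λ i j → ∑□ (f i j) n) n

  ∑□-cong : ∀ {f g} n → (∀ i j → i < n → j < n → f i j ≡ g i j) → ∑□ f n ≡ ∑□ g n
  ∑□-cong n eq = ∑-cong n (λ i i<n → ∑-cong n (λ j j<n → eq i j i<n j<n))

  ∑□-+ : ∀ f g n → ∑□ (λ i j → f i j + g i j) n ≡ ∑□ f n + ∑□ g n
  ∑□-+ f g n = trans (∑-cong n (λ i _ → ∑-+ (f i) (g i) n)) (∑-+ _ _ n)

  ∑□-* : ∀ c f n → ∑□ (λ i j → c * f i j) n ≡ c * ∑□ f n
  ∑□-* c f n = trans (∑-cong n (λ i _ → ∑-* c (f i) n)) (∑-* c _ n)

  ∑□-const : ∀ c n → ∑□ (λ _ _ → c) n ≡ n * (n * c)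
  ∑□-const c n = trans (∑-cong n (λ _ _ → ∑-const c n)) (∑-const (n * c) n)

  ∑□□-cong : ∀ {f g} n → (∀ i j a b → i < n → j < n → a < n → b < n → f i j a b ≡ g i j a b) →
             ∑□□ f n ≡ ∑□□ g n
  ∑□□-cong n eq = ∑□-cong n (λ i j i<n j<n → ∑□-cong n (λ a b a<n b<n → eq i j a b i<n j<n a<n b<n))

  ∑□□-+ : ∀ f g n → ∑□□ (λ i j a b → f i j a b + g i j a b) n ≡ ∑□□ f n + ∑□□ g n
  ∑□□-+ f g n = trans (∑□-cong n (λ i j _ _ → ∑□-+ (f i j) (g i j) n)) (∑□-+ _ _ n)

  ∑□□-* : ∀ c f n → ∑□□ (λ i j a b → c * f i j a b) n ≡ c * ∑□□ f n
  ∑□□-* c f n = trans (∑□-cong n (λ i j _ _ → ∑□-* c (f i j) n)) (∑□-* c _ n)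

  ∑□□-const : ∀ c n → ∑□□ (λ _ _ _ _ → c) n ≡ n * (n * (n * (n * c)))
  ∑□□-const c n = trans (∑□-cong n (λ _ _ _ _ → ∑□-const c n)) (∑□-const (n * (n * c)) n)

  row-pairs : ∀ n → ∑□□ (λ i j a b → δ b j) n ≡ n ^ 3
  row-pairs n = trans (∑□-cong n (λ i j _ j<n → trans (∑-cong n (λ _ _ → ∑-δ-below j<n)) (∑-const 1 n)))
                      (∑□-const (n * 1) n)

  column-pairs : ∀ n → ∑□□ (λ i j a b → δ a i) n ≡ n ^ 3
  column-pairs n = trans (∑□-cong n (λ i j i<n _ → column i<n)) (∑□-const (n * 1) n)
    where
    column : ∀ {i} → i < n → ∑□ (λ a b → δ a i) n ≡ n * 1
    column {i} i<n = begin
        ∑ (λ a → ∑ (λ _ → δ a i) n) n   ≡⟨ ∑-cong n (λ a _ → ∑-const (δ a i) n) ⟩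
        ∑ (λ a → n * δ a i) n           ≡⟨ ∑-* n (λ a → δ a i) n ⟩
        n * ∑ (λ a → δ a i) n           ≡⟨ cong (n *_) (∑-δ-below i<n) ⟩
        n * 1                           ∎

  equal-pairs : ∀ n → ∑□□ (λ i j a b → b2n (⌊ b ≟ j ⌋ ∧ ⌊ a ≟ i ⌋)) n ≡ n ^ 2
  equal-pairs n = trans (∑□-cong n (λ i j i<n j<n → only i<n j<n)) (∑□-const 1 n)
    where
    only : ∀ {i j} → i < n → j < n → ∑□ (λ a b → b2n (⌊ b ≟ j ⌋ ∧ ⌊ a ≟ i ⌋)) n ≡ 1
    only {i} {j} i<n j<n = begin
        ∑ (λ a → ∑ (λ b → b2n (⌊ b ≟ j ⌋ ∧ ⌊ a ≟ i ⌋)) n) n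
      ≡⟨ ∑-cong n (λ a _ → ∑-cong n (λ b _ → b2n-∧ ⌊ b ≟ j ⌋ ⌊ a ≟ i ⌋)) ⟩
        ∑ (λ a → ∑ (λ b → δ a i * δ b j) n) n
      ≡⟨ ∑-cong n (λ a _ → trans (∑-* (δ a i) (λ b → δ b j) n) (cong (δ a i *_) (∑-δ-below j<n))) ⟩
        ∑ (λ a → δ a i * 1) n
      ≡⟨ ∑-cong n (λ a _ → *-identityʳ (δ a i)) ⟩
        ∑ (λ a → δ a i) n
      ≡⟨ ∑-δ-below i<n ⟩
        1 ∎

  count-below : ∀ d n → ∑ (λ a → b2n ⌊ a + d <? n ⌋) n ≡ n ∸ d
  count-below d zero    = sym (0∸n≡0 d)
  count-below d (suc n) = begin
      ∑ (λ a → b2n ⌊ a + d <? suc n ⌋) (suc n)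
    ≡⟨ ∑-head _ n ⟩
      b2n ⌊ d <? suc n ⌋ + ∑ (λ a → b2n ⌊ suc (a + d) <? suc n ⌋) n
    ≡⟨ cong (b2n ⌊ d <? suc n ⌋ +_) (∑-cong n (λ a _ → cong b2n (⌊⌋-⇔ (suc (a + d) <? suc n) (a + d <? n) ≤-pred s≤s))) ⟩
      b2n ⌊ d <? suc n ⌋ + ∑ (λ a → b2n ⌊ a + d <? n ⌋) n
    ≡⟨ cong (b2n ⌊ d <? suc n ⌋ +_) (count-below d n) ⟩
      b2n ⌊ d <? suc n ⌋ + (n ∸ d)
    ≡⟨ first-term ⟩
      suc n ∸ d ∎
    where
    first-term : b2n ⌊ d <? suc n ⌋ + (n ∸ d) ≡ suc n ∸ d
    first-term with d ≤? n
    ... | yes d≤n rewrite ⌊⌋-true (d <? suc n) (s≤s d≤n) = sym (+-∸-assoc 1 d≤n)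
    ... | no d≰n rewrite ⌊⌋-false (d <? suc n) (λ d<1+n → d≰n (≤-pred d<1+n))
      = trans (m≤n⇒m∸n≡0 (<⇒≤ (≰⇒> d≰n))) (sym (m≤n⇒m∸n≡0 (≰⇒> d≰n)))

  offset-pairs : ∀ {d n} → d ≤ n → ∑ (λ a → ∑ (λ b → δ b (a + d)) n) n + d ≡ n
  offset-pairs {d} {n} d≤n = begin
      ∑ (λ a → ∑ (λ b → δ b (a + d)) n) n + d
    ≡⟨ cong (_+ d) (∑-cong n (λ a _ → ∑-δ (a + d) n)) ⟩
      ∑ (λ a → b2n ⌊ a + d <? n ⌋) n + d
    ≡⟨ cong (_+ d) (count-below d n) ⟩
      (n ∸ d) + d
    ≡⟨ m∸n+n≡m d≤n ⟩
      n ∎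

  diagonal-through : ∀ {n i j} → i < n → j < n → ∑□ (λ a b → δ (a + j) (b + i)) n + ∣ i - j ∣ ≡ n
  diagonal-through {n} {i} {j} i<n j<n with ≤-total i j
  ... | inj₁ i≤j with m≤n⇒∃[o]m+o≡n i≤j
  ...   | d , refl = begin
      ∑□ (λ a b → δ (a + (i + d)) (b + i)) n + ∣ i - i + d ∣
    ≡⟨ cong₂ _+_ (∑□-cong n (λ a b _ _ → cong b2n (⌊⌋-⇔ _ (b ≟ a + d) to (from {a} {b}))))
                  (∣m-m+n∣≡n i d) ⟩
      ∑ (λ a → ∑ (λ b → δ b (a + d)) n) n + d
    ≡⟨ offset-pairs (≤-trans (m≤n+m d i) (<⇒≤ j<n)) ⟩
      n ∎
    where
    to : ∀ {a b} → a + (i + d) ≡ b + i → b ≡ a + d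
    to {a} {b} e = +-cancelʳ-≡ i b (a + d)
      (sym (trans (solve 3 (λ a d i → (a :+ d) :+ i := a :+ (i :+ d)) refl a d i) e))
    from : ∀ {a b} → b ≡ a + d → a + (i + d) ≡ b + i
    from {a} refl = solve 3 (λ a d i → a :+ (i :+ d) := (a :+ d) :+ i) refl a d i
  diagonal-through {n} {i} {j} i<n j<n | inj₂ j≤i with m≤n⇒∃[o]m+o≡n j≤i
  ...   | d , refl = begin
      ∑□ (λ a b → δ (a + j) (b + (j + d))) n + ∣ j + d - j ∣
    ≡⟨ cong₂ _+_ (∑-swap (λ a b → δ (a + j) (b + (j + d))) n n)
                  (trans (∣-∣-comm (j + d) j) (∣m-m+n∣≡n j d)) ⟩
      ∑ (λ b → ∑ (λ a → δ (a + j) (b + (j + d))) n) n + d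
    ≡⟨ cong (_+ d) (∑□-cong n (λ b a _ _ → cong b2n (⌊⌋-⇔ _ (a ≟ b + d) to (from {a} {b})))) ⟩
      ∑ (λ b → ∑ (λ a → δ a (b + d)) n) n + d
    ≡⟨ offset-pairs (≤-trans (m≤n+m d j) (<⇒≤ i<n)) ⟩
      n ∎
    where
    to : ∀ {a b} → a + j ≡ b + (j + d) → a ≡ b + d
    to {a} {b} e = +-cancelʳ-≡ j a (b + d)
      (trans e (solve 3 (λ b d j → b :+ (j :+ d) := (b :+ d) :+ j) refl b d j))
    from : ∀ {a b} → a ≡ b + d → a + j ≡ b + (j + d)
    from {a} {b} refl = solve 3 (λ b d j → (b :+ d) :+ j := b :+ (j :+ d)) refl b d j

  dist-suc : ∀ {i n} → i ≤ n → ∣ i - suc n ∣ ≡ suc ∣ i - n ∣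
  dist-suc {i} i≤n with m≤n⇒∃[o]m+o≡n i≤n
  ... | o , refl = trans (cong ∣ i -_∣ (sym (+-suc i o)))
                         (trans (∣m-m+n∣≡n i (suc o)) (cong suc (sym (∣m-m+n∣≡n i o))))

  distances-to : ∀ n → 2 * ∑ (λ i → ∣ i - n ∣) n ≡ n * suc n
  distances-to zero    = refl
  distances-to (suc n) = begin
      2 * (∑ (λ i → ∣ i - suc n ∣) n + ∣ n - suc n ∣)
    ≡⟨ cong (λ t → 2 * (t + ∣ n - suc n ∣)) (∑-cong n (λ i i<n → dist-suc (<⇒≤ i<n))) ⟩
      2 * (∑ (λ i → suc ∣ i - n ∣) n + ∣ n - suc n ∣)
    ≡⟨ cong₂ (λ s t → 2 * (s + t)) (∑-+ (λ _ → 1) (λ i → ∣ i - n ∣) n)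
                                    (trans (dist-suc {n} ≤-refl) (cong suc (∣n-n∣≡0 n))) ⟩
      2 * (∑ (λ _ → 1) n + T + 1)
    ≡⟨ cong (λ s → 2 * (s + T + 1)) (trans (∑-const 1 n) (*-identityʳ n)) ⟩
      2 * (n + T + 1)
    ≡⟨ solve 2 (λ n t → con 2 :* (n :+ t :+ con 1) := con 2 :* t :+ con 2 :* (n :+ con 1)) refl n T ⟩
      2 * T + 2 * (n + 1)
    ≡⟨ cong (_+ 2 * (n + 1)) (distances-to n) ⟩
      n * suc n + 2 * (n + 1)
    ≡⟨ solve 1 (λ n → n :* (con 1 :+ n) :+ con 2 :* (n :+ con 1)
                    := (con 1 :+ n) :* (con 1 :+ (con 1 :+ n))) refl n ⟩
      suc n * suc (suc n) ∎
    where
    T : ℕ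
    T = ∑ (λ i → ∣ i - n ∣) n

  distance-sum : ∀ n → 3 * ∑□ (λ i j → ∣ i - j ∣) n + n ≡ n ^ 3
  distance-sum zero    = refl
  distance-sum (suc n) = begin
      3 * ∑□ (λ i j → ∣ i - j ∣) (suc n) + suc n
    ≡⟨ cong (λ e → 3 * e + suc n) grow ⟩
      3 * (E + T + T) + suc n
    ≡⟨ solve 3 (λ e t n → con 3 :* (e :+ t :+ t) :+ (con 1 :+ n)
                        := (con 3 :* e :+ n) :+ con 3 :* (con 2 :* t) :+ con 1) refl E T n ⟩
      (3 * E + n) + 3 * (2 * T) + 1
    ≡⟨ cong₂ (λ x y → x + 3 * y + 1) (distance-sum n) (distances-to n) ⟩
      n ^ 3 + 3 * (n * suc n) + 1
    ≡⟨ solve 1 (λ n → n :* (n :* (n :* con 1)) :+ con 3 :* (n :* (con 1 :+ n)) :+ con 1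
                    := (con 1 :+ n) :* ((con 1 :+ n) :* ((con 1 :+ n) :* con 1))) refl n ⟩
      suc n ^ 3 ∎
    where
    E T : ℕ
    E = ∑□ (λ i j → ∣ i - j ∣) n
    T = ∑ (λ i → ∣ i - n ∣) n
    -- Adding a last row and column adds the distances to the new index twice.
    grow : ∑□ (λ i j → ∣ i - j ∣) (suc n) ≡ E + T + T
    grow = cong₂ _+_ (∑-+ (λ i → ∑ (λ j → ∣ i - j ∣) n) (λ i → ∣ i - n ∣) n)
                     (trans (cong₂ _+_ (∑-cong n (λ j _ → ∣-∣-comm n j)) (∣n-n∣≡0 n)) (+-identityʳ T))

  diagonal-pairs : ∀ n → 3 * ∑□□ (λ i j a b → δ (a + j) (b + i)) n ≡ 2 * n ^ 3 + n
  diagonal-pairs n = +-cancelʳ-≡ (n ^ 3) _ _ (begin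
      3 * D + n ^ 3
    ≡⟨ cong (3 * D +_) (sym (distance-sum n)) ⟩
      3 * D + (3 * E + n)
    ≡⟨ solve 3 (λ d e n → con 3 :* d :+ (con 3 :* e :+ n) := con 3 :* (d :+ e) :+ n) refl D E n ⟩
      3 * (D + E) + n
    ≡⟨ cong (λ x → 3 * x + n) D+E ⟩
      3 * (n * (n * n)) + n
    ≡⟨ solve 1 (λ n → con 3 :* (n :* (n :* n)) :+ n
                    := (con 2 :* (n :* (n :* (n :* con 1))) :+ n) :+ n :* (n :* (n :* con 1))) refl n ⟩
      2 * n ^ 3 + n + n ^ 3 ∎)
    where
    D E : ℕ
    D = ∑□□ (λ i j a b → δ (a + j) (b + i)) n
    E = ∑□ (λ i j → ∣ i - j ∣) n
    D+E : D + E ≡ n * (n * n)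
    D+E = trans (sym (∑□-+ _ _ n)) (trans (∑□-cong n (λ i j → diagonal-through)) (∑□-const n n))

  -- Reflecting j ↦ n−1−j and b ↦ n−1−b turns anti-diagonals into diagonals.
  reflect : ∀ {n i j a b p q} → p + suc b ≡ n → q + suc j ≡ n →
            (a + p ≡ i + q → a + j ≡ b + i) × (a + j ≡ b + i → a + p ≡ i + q)
  reflect {n} {i} {j} {a} {b} {p} {q} p+b q+j =
      (λ e → +-cancelʳ-≡ n _ _ (trans (sym left) (trans (cong (_+ suc (b + j)) e) right)))
    , (λ e → +-cancelʳ-≡ (suc (b + j)) _ _ (trans left (trans (cong (_+ n) e) (sym right))))
    where
    left : a + p + suc (b + j) ≡ a + j + n
    left = trans (solve 4 (λ a j p b → a :+ p :+ (con 1 :+ (b :+ j)) := a :+ j :+ (p :+ (con 1 :+ b))) refl a j p b)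
                 (cong (a + j +_) p+b)
    right : i + q + suc (b + j) ≡ b + i + n
    right = trans (solve 4 (λ i q b j → i :+ q :+ (con 1 :+ (b :+ j)) := b :+ i :+ (q :+ (con 1 :+ j))) refl i q b j)
                  (cong (b + i +_) q+j)

  antidiagonal-pairs : ∀ n → ∑□□ (λ i j a b → δ (a + b) (i + j)) n ≡ ∑□□ (λ i j a b → δ (a + j) (b + i)) n
  antidiagonal-pairs n = ∑-cong n (λ i _ → trans (∑-reverse _ n) (∑-cong n (λ j j<n → ∑-cong n (λ a _ →
      trans (∑-reverse _ n) (∑-cong n (λ b b<n →
        let (to , from) = reflect {n} {i} {j} {a} {b} (m∸n+n≡m b<n) (m∸n+n≡m j<n)
        in cong b2n (⌊⌋-⇔ _ _ to from)))))))

  ΣL : {A : Set} → (A → ℕ) → List A → ℕ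
  ΣL f []       = 0
  ΣL f (x ∷ xs) = f x + ΣL f xs

  ΣL-cong : ∀ {A : Set} {f g : A → ℕ} xs → (∀ x → f x ≡ g x) → ΣL f xs ≡ ΣL g xs
  ΣL-cong []       eq = refl
  ΣL-cong (x ∷ xs) eq = cong₂ _+_ (eq x) (ΣL-cong xs eq)

  ΣL-++ : ∀ {A : Set} (f : A → ℕ) xs ys → ΣL f (xs ++ ys) ≡ ΣL f xs + ΣL f ys
  ΣL-++ f []       ys = refl
  ΣL-++ f (x ∷ xs) ys = trans (cong (f x +_) (ΣL-++ f xs ys)) (sym (+-assoc (f x) _ _))

  ΣL-+ : ∀ {A : Set} (f g : A → ℕ) xs → ΣL (λ x → f x + g x) xs ≡ ΣL f xs + ΣL g xs
  ΣL-+ f g []       = refl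
  ΣL-+ f g (x ∷ xs) = trans (cong (f x + g x +_) (ΣL-+ f g xs))
    (solve 4 (λ a b c d → (a :+ b) :+ (c :+ d) := (a :+ c) :+ (b :+ d)) refl (f x) (g x) (ΣL f xs) (ΣL g xs))

  ΣL-map : ∀ {A B : Set} (f : B → ℕ) (g : A → B) xs → ΣL f (map g xs) ≡ ΣL (λ x → f (g x)) xs
  ΣL-map f g []       = refl
  ΣL-map f g (x ∷ xs) = cong (f (g x) +_) (ΣL-map f g xs)

  ΣL-concat : ∀ {A : Set} (f : A → ℕ) xss → ΣL f (concat xss) ≡ ΣL (ΣL f) xss
  ΣL-concat f []         = refl
  ΣL-concat f (xs ∷ xss) = trans (ΣL-++ f xs (concat xss)) (cong (ΣL f xs +_) (ΣL-concat f xss))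

  ΣL-applyUpTo : ∀ {A : Set} (f : A → ℕ) (g : ℕ → A) n → ΣL f (applyUpTo g n) ≡ ∑ (λ i → f (g i)) n
  ΣL-applyUpTo f g zero    = refl
  ΣL-applyUpTo f g (suc n) =
    trans (cong (f (g 0) +_) (ΣL-applyUpTo f (λ i → g (suc i)) n)) (sym (∑-head (λ i → f (g i)) n))

  length-filterᵇ : ∀ {A : Set} (p : A → Bool) xs → length (filterᵇ p xs) ≡ ΣL (λ x → b2n (p x)) xs
  length-filterᵇ p []       = refl
  length-filterᵇ p (x ∷ xs) with p x
  ... | true  = cong suc (length-filterᵇ p xs)
  ... | false = length-filterᵇ p xs

  pairs-double-count : ∀ {A : Set} (F : A × A → ℕ) → (∀ x y → F (x , y) ≡ F (y , x)) → ∀ xs →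
    2 * ΣL F (pairs xs) + ΣL (λ x → F (x , x)) xs ≡ ΣL (λ x → ΣL (λ y → F (x , y)) xs) xs
  pairs-double-count F F-sym []       = refl
  pairs-double-count F F-sym (x ∷ xs) = begin
      2 * ΣL F (map (λ y → (x , y)) xs ++ pairs xs) + (F (x , x) + Diag)
    ≡⟨ cong (λ s → 2 * s + (F (x , x) + Diag))
            (trans (ΣL-++ F (map (λ y → (x , y)) xs) (pairs xs)) (cong (_+ Pairs) (ΣL-map F (λ y → (x , y)) xs))) ⟩
      2 * (Row + Pairs) + (F (x , x) + Diag)
    ≡⟨ solve 4 (λ r p f d → con 2 :* (r :+ p) :+ (f :+ d) := (f :+ r) :+ (r :+ (con 2 :* p :+ d)))
             refl Row Pairs (F (x , x)) Diag ⟩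
      (F (x , x) + Row) + (Row + (2 * Pairs + Diag))
    ≡⟨ cong₂ (λ r s → (F (x , x) + Row) + (r + s)) (ΣL-cong xs (F-sym x)) (pairs-double-count F F-sym xs) ⟩
      (F (x , x) + Row) + (ΣL (λ y → F (y , x)) xs + ΣL (λ y → ΣL (λ z → F (y , z)) xs) xs)
    ≡⟨ cong ((F (x , x) + Row) +_) (sym (ΣL-+ _ _ xs)) ⟩
      (F (x , x) + Row) + ΣL (λ y → F (y , x) + ΣL (λ z → F (y , z)) xs) xs ∎
    where
    Row Pairs Diag : ℕ
    Row   = ΣL (λ y → F (x , y)) xs
    Pairs = ΣL F (pairs xs)
    Diag  = ΣL (λ y → F (y , y)) xs

  -- The square with 0-based coordinates (i,j).
  sq : ℕ → ℕ → Square
  sq i j = (+[1+ i ] , +[1+ j ])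

  ΣL-board : ∀ (f : Square → ℕ) n → ΣL f (board n) ≡ ∑□ (λ i j → f (sq i j)) n
  ΣL-board f n = begin
      ΣL f (concat (map (λ x → map (λ y → (x , y)) (range n)) (range n)))
    ≡⟨ ΣL-concat f (map (λ x → map (λ y → (x , y)) (range n)) (range n)) ⟩
      ΣL (ΣL f) (map (λ x → map (λ y → (x , y)) (range n)) (range n))
    ≡⟨ ΣL-map (ΣL f) _ (range n) ⟩
      ΣL (λ x → ΣL f (map (λ y → (x , y)) (range n))) (range n)
    ≡⟨ ΣL-cong (range n) (λ x → ΣL-map f _ (range n)) ⟩
      ΣL (λ x → ΣL (λ y → f (x , y)) (range n)) (range n)
    ≡⟨ on-range _ ⟩
      ∑ (λ i → ΣL (λ y → f (+[1+ i ] , y)) (range n)) n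
    ≡⟨ ∑-cong n (λ i _ → on-range _) ⟩
      ∑□ (λ i j → f (sq i j)) n ∎
    where
    on-range : ∀ (g : ℤ → ℕ) → ΣL g (range n) ≡ ∑ (λ i → g +[1+ i ]) n
    on-range g = trans (ΣL-map g (λ i → +[1+ i ]) (upTo n)) (ΣL-applyUpTo (λ i → g +[1+ i ]) (λ i → i) n)

  -- Board coordinates are shifted by one; cross sums are unaffected.
  shift-sucs : ∀ a j b i → (suc a + suc j ≡ suc b + suc i → a + j ≡ b + i) × (a + j ≡ b + i → suc a + suc j ≡ suc b + suc i)
  shift-sucs a j b i =
      (λ e → suc-injective (suc-injective (trans (sym (two a j)) (trans e (two b i)))))
    , (λ e → trans (two a j) (trans (cong (λ s → suc (suc s)) e) (sym (two b i))))
    where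
    two : ∀ m n → suc m + suc n ≡ suc (suc (m + n))
    two m n = cong suc (+-suc m n)

  axis-test : ∀ j b → eqℤ (+[1+ b ] ℤ.- +[1+ j ]) +0 ≡ ⌊ b ≟ j ⌋
  axis-test j b = ⌊⌋-⇔ _ (b ≟ j) (λ e → suc-injective (ℤP.+-injective (ℤP.i-j≡0⇒i≡j _ _ e)))
                                 (λ e → ℤP.i≡j⇒i-j≡0 (cong +[1+_] e))

  diagonal-test : ∀ i j a b → eqℤ (+[1+ a ] ℤ.- +[1+ i ]) (+[1+ b ] ℤ.- +[1+ j ]) ≡ ⌊ a + j ≟ b + i ⌋
  diagonal-test i j a b = ⌊⌋-⇔ _ (a + j ≟ b + i)
    (λ e → proj₁ (shift-sucs a j b i) (ℤP.+-injective (proj₁ (sub-≡-sub +[1+ a ] +[1+ i ] +[1+ b ] +[1+ j ]) e)))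
    (λ e → proj₂ (sub-≡-sub +[1+ a ] +[1+ i ] +[1+ b ] +[1+ j ]) (cong ℤ.+_ (proj₂ (shift-sucs a j b i) e)))

  antidiagonal-test : ∀ i j a b → eqℤ (+[1+ a ] ℤ.- +[1+ i ]) (ℤ.- (+[1+ b ] ℤ.- +[1+ j ])) ≡ ⌊ a + b ≟ i + j ⌋
  antidiagonal-test i j a b = ⌊⌋-⇔ _ (a + b ≟ i + j)
    (λ e → proj₁ (shift-sucs a b i j) (ℤP.+-injective (proj₁ (sub-≡-neg-sub +[1+ a ] +[1+ i ] +[1+ b ] +[1+ j ]) e)))
    (λ e → proj₂ (sub-≡-neg-sub +[1+ a ] +[1+ i ] +[1+ b ] +[1+ j ]) (cong ℤ.+_ (proj₂ (shift-sucs a b i j) e)))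

  attackVia : Piece → Bool → Bool → Bool → Bool → Bool
  attackVia (piece pa pb pc pd) row col diag anti = (row ∧ pa) ∨ (col ∧ pb) ∨ (diag ∧ pc) ∨ (anti ∧ pd)

  through : ∀ {ℓ} {A : Set ℓ} → (Bool → Bool → Bool → Bool → A) → ℕ → ℕ → ℕ → ℕ → A
  through f i j a b = f ⌊ b ≟ j ⌋ ⌊ a ≟ i ⌋ ⌊ a + j ≟ b + i ⌋ ⌊ a + b ≟ i + j ⌋

  attacks-sq : ∀ P i j a b → attacks P (sq i j) (sq a b) ≡ through (attackVia P) i j a b
  attacks-sq (piece pa pb pc pd) i j a b =
    cong₂ _∨_ (guard pa (axis-test j b)) (cong₂ _∨_ (guard pb (axis-test i a))
      (cong₂ _∨_ (guard pc (diagonal-test i j a b)) (guard pd (antidiagonal-test i j a b))))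
    where
    guard : ∀ p {x y} → x ≡ y → (if p then x else false) ≡ y ∧ p
    guard true  {x} refl = sym (∧-identityʳ x)
    guard false {x} refl = sym (∧-zeroʳ x)

  -- Every line test is symmetric, hence so is attacking.
  attacks-symmetric : ∀ P i j a b → attacks P (sq a b) (sq i j) ≡ attacks P (sq i j) (sq a b)
  attacks-symmetric P i j a b = begin
      attacks P (sq a b) (sq i j)     ≡⟨ attacks-sq P a b i j ⟩
      through (attackVia P) a b i j   ≡⟨ swap-tests ⟩
      through (attackVia P) i j a b   ≡⟨ sym (attacks-sq P i j a b) ⟩
      attacks P (sq i j) (sq a b)     ∎
    where
    flip : ∀ {w x y z} → w + x ≡ y + z → z + y ≡ x + w
    flip {w} {x} {y} {z} e = trans (+-comm z y) (trans (sym e) (+-comm w x))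
    swap-tests : through (attackVia P) a b i j ≡ through (attackVia P) i j a b
    swap-tests
      rewrite ⌊⌋-⇔ (j ≟ b) (b ≟ j) sym sym | ⌊⌋-⇔ (i ≟ a) (a ≟ i) sym sym
            | ⌊⌋-⇔ (i + b ≟ j + a) (a + j ≟ b + i) (flip {i} {b} {j} {a}) (flip {a} {j} {b} {i})
            | ⌊⌋-⇔ (i + j ≟ a + b) (a + b ≟ i + j) sym sym = refl

  anyFlag : Piece → Bool
  anyFlag (piece pa pb pc pd) = pa ∨ pb ∨ pc ∨ pd

  some-move : ∀ P → 1 ≤ hOf P + kOf P → anyFlag P ≡ true
  some-move (piece true  _     _     _    ) _ = refl
  some-move (piece false true  _     _    ) _ = refl
  some-move (piece false false true  _    ) _ = refl
  some-move (piece false false false true ) _ = refl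
  some-move (piece false false false false) ()

  attacks-self : ∀ P i j → attacks P (sq i j) (sq i j) ≡ anyFlag P
  attacks-self P@(piece pa pb pc pd) i j = trans (attacks-sq P i j i j) on-all-lines
    where
    on-all-lines : through (attackVia P) i j i j ≡ anyFlag P
    on-all-lines
      rewrite ⌊⌋-true (j ≟ j) refl | ⌊⌋-true (i ≟ i) refl
            | ⌊⌋-true (i + j ≟ j + i) (+-comm i j) | ⌊⌋-true (i + j ≟ i + j) refl = refl

  -- The possible outcomes of the four tests for squares z and w: either
  -- z = w and all lines through z contain w, or w lies on at most one of them.
  data Incidence : Bool → Bool → Bool → Bool → Set where
    same         : Incidence true  true  true  true
    apart        : Incidence false false false false
    onRow        : Incidence true  false false false
    onColumn     : Incidence false true  false false
    onDiagonal   : Incidence false false true  false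
    onAntidiag   : Incidence false false false true

  diagonals-meet-once : ∀ {i j a b} → a + j ≡ b + i → a + b ≡ i + j → a ≡ i
  diagonals-meet-once {i} {j} {a} {b} d e = *-cancelˡ-≡ a i 2 (+-cancelʳ-≡ (j + b) (2 * a) (2 * i) (begin
      2 * a + (j + b)       ≡⟨ solve 3 (λ a j b → con 2 :* a :+ (j :+ b) := (a :+ j) :+ (a :+ b)) refl a j b ⟩
      (a + j) + (a + b)     ≡⟨ cong₂ _+_ d e ⟩
      (b + i) + (i + j)     ≡⟨ solve 3 (λ i j b → (b :+ i) :+ (i :+ j) := con 2 :* i :+ (j :+ b)) refl i j b ⟩
      2 * i + (j + b)       ∎))

  -- Two distinct lines through a square meet only there.
  incidence : ∀ i j a b → through Incidence i j a b
  incidence i j a b with b ≟ j | a ≟ i | a + j ≟ b + i | a + b ≟ i + j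
  ... | yes _    | yes _    | yes _ | yes _  = same
  ... | yes refl | yes refl | no ¬d | _      = contradiction (+-comm i j) ¬d
  ... | yes refl | yes refl | yes _ | no ¬e  = contradiction refl ¬e
  ... | yes refl | no a≢i   | yes d | _      = contradiction (+-cancelʳ-≡ j a i (trans d (+-comm j i))) a≢i
  ... | yes refl | no a≢i   | no _  | yes e  = contradiction (+-cancelʳ-≡ j a i e) a≢i
  ... | yes _    | no _     | no _  | no _   = onRow
  ... | no b≢j   | yes refl | yes d | _      = contradiction (sym (+-cancelˡ-≡ i j b (trans d (+-comm b i)))) b≢j
  ... | no b≢j   | yes refl | no _  | yes e  = contradiction (+-cancelˡ-≡ i b j e) b≢j
  ... | no _     | yes _    | no _  | no _   = onColumn
  ... | no _     | no a≢i   | yes d | yes e  = contradiction (diagonals-meet-once d e) a≢i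
  ... | no _     | no _     | yes _ | no _   = onDiagonal
  ... | no _     | no _     | no _  | yes _  = onAntidiag
  ... | no _     | no _     | no _  | no _   = apart

  lineCount : Piece → Bool → Bool → Bool → Bool → ℕ
  lineCount (piece pa pb pc pd) row col diag anti =
    (b2n (row ∧ pa) + b2n (col ∧ pb)) + (b2n (diag ∧ pc) + b2n (anti ∧ pd))

  attack-indicator : ∀ P {row col diag anti} → anyFlag P ≡ true → Incidence row col diag anti →
    b2n (attackVia P row col diag anti) + (hOf P + kOf P) * b2n (row ∧ col)
      ≡ lineCount P row col diag anti + b2n (row ∧ col)
  attack-indicator P@(piece _ _ _ _)     h same rewrite h =
    trans (cong suc (*-identityʳ (hOf P + kOf P))) (+-comm 1 (hOf P + kOf P))
  attack-indicator P                     _ apart        = *-zeroʳ (hOf P + kOf P)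
  attack-indicator P@(piece true  _ _ _) _ onRow        = cong suc (*-zeroʳ (hOf P + kOf P))
  attack-indicator P@(piece false _ _ _) _ onRow        = *-zeroʳ (hOf P + kOf P)
  attack-indicator P@(piece _ true  _ _) _ onColumn     = cong suc (*-zeroʳ (hOf P + kOf P))
  attack-indicator P@(piece _ false _ _) _ onColumn     = *-zeroʳ (hOf P + kOf P)
  attack-indicator P@(piece _ _ true  _) _ onDiagonal   = cong suc (*-zeroʳ (hOf P + kOf P))
  attack-indicator P@(piece _ _ false _) _ onDiagonal   = *-zeroʳ (hOf P + kOf P)
  attack-indicator P@(piece _ _ _ pd)    _ onAntidiag   = cong (b2n pd +_) (*-zeroʳ (hOf P + kOf P))

  diagonalPairs : ℕ → ℕ
  diagonalPairs n = ∑□□ (λ i j a b → δ (a + j) (b + i)) n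

  attackingPairs : Piece → ℕ → ℕ
  attackingPairs P n = ∑□□ (λ i j a b → b2n (attacks P (sq i j) (sq a b))) n

  nonattacking-sym : ∀ P z w → nonattacking P (z , w) ≡ nonattacking P (w , z)
  nonattacking-sym P z w with attacks P z w | attacks P w z
  ... | true  | true  = refl
  ... | true  | false = refl
  ... | false | true  = refl
  ... | false | false = refl

  nonattacking-complement : ∀ P z w → attacks P w z ≡ attacks P z w →
    b2n (nonattacking P (z , w)) + b2n (attacks P z w) ≡ 1
  nonattacking-complement P z w sym-zw rewrite sym-zw with attacks P z w
  ... | true  = refl
  ... | false = refl

  -- 2·u(2;n) is the number of ordered pairs of squares that do not attack:
  -- each 2-subset gives two ordered pairs, and (z,z) is always attacking.
  twice-u2 : ∀ P n → anyFlag P ≡ true →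
    2 * u2 P n ≡ ∑□□ (λ i j a b → b2n (nonattacking P (sq i j , sq a b))) n
  twice-u2 P n moves = begin
      2 * u2 P n
    ≡⟨ cong (2 *_) (length-filterᵇ (nonattacking P) (pairs (board n))) ⟩
      2 * ΣL F (pairs (board n))
    ≡⟨ sym (+-identityʳ _) ⟩
      2 * ΣL F (pairs (board n)) + 0
    ≡⟨ cong (2 * ΣL F (pairs (board n)) +_) (sym no-self-pairs) ⟩
      2 * ΣL F (pairs (board n)) + ΣL (λ z → F (z , z)) (board n)
    ≡⟨ pairs-double-count F (λ z w → cong b2n (nonattacking-sym P z w)) (board n) ⟩
      ΣL (λ z → ΣL (λ w → F (z , w)) (board n)) (board n)
    ≡⟨ trans (ΣL-board _ n) (∑□-cong n (λ i j _ _ → ΣL-board _ n)) ⟩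
      ∑□□ (λ i j a b → F (sq i j , sq a b)) n ∎
    where
    F : Square × Square → ℕ
    F zw = b2n (nonattacking P zw)
    no-self-pairs : ΣL (λ z → F (z , z)) (board n) ≡ 0
    no-self-pairs = begin
        ΣL (λ z → F (z , z)) (board n)   ≡⟨ ΣL-board _ n ⟩
        ∑□ (λ i j → F (sq i j , sq i j)) n
      ≡⟨ ∑□-cong n (λ i j _ _ → cong (λ t → b2n (if t then false else (if t then false else true)))
                                      (trans (attacks-self P i j) moves)) ⟩
        ∑□ (λ _ _ → 0) n                 ≡⟨ ∑□-const 0 n ⟩
        n * (n * 0)                      ≡⟨ trans (cong (n *_) (*-zeroʳ n)) (*-zeroʳ n) ⟩
        0                                ∎

  nonattacking-pairs : ∀ P n → anyFlag P ≡ true → 2 * u2 P n + attackingPairs P n ≡ n ^ 4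
  nonattacking-pairs P n moves = begin
      2 * u2 P n + attackingPairs P n
    ≡⟨ cong (_+ attackingPairs P n) (twice-u2 P n moves) ⟩
      ∑□□ (λ i j a b → b2n (nonattacking P (sq i j , sq a b))) n + attackingPairs P n
    ≡⟨ sym (∑□□-+ _ _ n) ⟩
      ∑□□ (λ i j a b → b2n (nonattacking P (sq i j , sq a b)) + b2n (attacks P (sq i j) (sq a b))) n
    ≡⟨ ∑□□-cong n (λ i j a b _ _ _ _ →
         nonattacking-complement P (sq i j) (sq a b) (attacks-symmetric P i j a b)) ⟩
      ∑□□ (λ _ _ _ _ → 1) n
    ≡⟨ ∑□□-const 1 n ⟩
      n ^ 4 ∎

  flagged : ∀ p (t : ℕ → ℕ → ℕ → ℕ → Bool) n {C} → ∑□□ (λ i j a b → b2n (t i j a b)) n ≡ C →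
            ∑□□ (λ i j a b → b2n (t i j a b ∧ p)) n ≡ b2n p * C
  flagged p t n count = trans (∑□□-cong n (λ i j a b _ _ _ _ → b2n-∧ (t i j a b) p))
                                (trans (∑□□-* (b2n p) (λ i j a b → b2n (t i j a b)) n) (cong (b2n p *_) count))

  line-pairs : ∀ P n → ∑□□ (through (lineCount P)) n ≡ hOf P * n ^ 3 + kOf P * diagonalPairs n
  line-pairs (piece pa pb pc pd) n = begin
      ∑□□ (λ i j a b → (R i j a b + C i j a b) + (D i j a b + A i j a b)) n
    ≡⟨ trans (∑□□-+ (λ i j a b → R i j a b + C i j a b) (λ i j a b → D i j a b + A i j a b) n)
             (cong₂ _+_ (∑□□-+ R C n) (∑□□-+ D A n)) ⟩
      (∑□□ R n + ∑□□ C n) + (∑□□ D n + ∑□□ A n)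
    ≡⟨ cong₂ _+_ (cong₂ _+_ (flagged pa sameRow n (row-pairs n)) (flagged pb sameColumn n (column-pairs n)))
                 (cong₂ _+_ (flagged pc sameDiagonal n refl) (flagged pd sameAntidiag n (antidiagonal-pairs n))) ⟩
      (b2n pa * n ^ 3 + b2n pb * n ^ 3) + (b2n pc * diagonalPairs n + b2n pd * diagonalPairs n)
    ≡⟨ sym (cong₂ _+_ (*-distribʳ-+ (n ^ 3) (b2n pa) (b2n pb)) (*-distribʳ-+ (diagonalPairs n) (b2n pc) (b2n pd))) ⟩
      (b2n pa + b2n pb) * n ^ 3 + (b2n pc + b2n pd) * diagonalPairs n ∎
    where
    sameRow sameColumn sameDiagonal sameAntidiag : ℕ → ℕ → ℕ → ℕ → Bool
    sameRow      i j a b = ⌊ b ≟ j ⌋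
    sameColumn   i j a b = ⌊ a ≟ i ⌋
    sameDiagonal i j a b = ⌊ a + j ≟ b + i ⌋
    sameAntidiag i j a b = ⌊ a + b ≟ i + j ⌋
    R C D A : ℕ → ℕ → ℕ → ℕ → ℕ
    R i j a b = b2n (sameRow i j a b ∧ pa)
    C i j a b = b2n (sameColumn i j a b ∧ pb)
    D i j a b = b2n (sameDiagonal i j a b ∧ pc)
    A i j a b = b2n (sameAntidiag i j a b ∧ pd)

  attacking-pairs : ∀ P n → anyFlag P ≡ true →
    attackingPairs P n + (hOf P + kOf P) * n ^ 2 ≡ hOf P * n ^ 3 + kOf P * diagonalPairs n + n ^ 2
  attacking-pairs P n moves = begin
      attackingPairs P n + m * n ^ 2
    ≡⟨ cong (λ s → attackingPairs P n + m * s) (sym (equal-pairs n)) ⟩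
      attackingPairs P n + m * ∑□□ Same n
    ≡⟨ cong (attackingPairs P n +_) (sym (∑□□-* m Same n)) ⟩
      attackingPairs P n + ∑□□ (λ i j a b → m * Same i j a b) n
    ≡⟨ sym (∑□□-+ _ _ n) ⟩
      ∑□□ (λ i j a b → b2n (attacks P (sq i j) (sq a b)) + m * Same i j a b) n
    ≡⟨ ∑□□-cong n (λ i j a b _ _ _ _ → trans (cong (λ t → b2n t + m * Same i j a b) (attacks-sq P i j a b))
                                             (attack-indicator P moves (incidence i j a b))) ⟩
      ∑□□ (λ i j a b → through (lineCount P) i j a b + Same i j a b) n
    ≡⟨ ∑□□-+ _ _ n ⟩
      ∑□□ (through (lineCount P)) n + ∑□□ Same n
    ≡⟨ cong₂ _+_ (line-pairs P n) (equal-pairs n) ⟩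
      hOf P * n ^ 3 + kOf P * diagonalPairs n + n ^ 2 ∎
    where
    m : ℕ
    m = hOf P + kOf P
    Same : ℕ → ℕ → ℕ → ℕ → ℕ
    Same i j a b = b2n (⌊ b ≟ j ⌋ ∧ ⌊ a ≟ i ⌋)

open Counting using (diagonalPairs; attackingPairs; anyFlag; some-move; nonattacking-pairs; attacking-pairs; diagonal-pairs)

open import Data.Integer using (ℤ; +_; _*_; _-_; _+_; _^_)
import Data.Integer.Properties as ℤP
open import Data.Integer.Solver using (module +-*-Solver)
open +-*-Solver using (solve; _:+_; _:*_; _:-_; _:^_; _:=_; con)
open ≡-Reasoning

closed-form-ℤ : ∀ (U T D N H K : ℤ) →
  + 2 * U + T ≡ N ^ 4 →
  T + (H + K) * N ^ 2 ≡ H * N ^ 3 + K * D + N ^ 2 →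
  + 3 * D ≡ + 2 * N ^ 3 + N →
  + 6 * U ≡ + 3 * N ^ 4 - (+ 3 * H + + 2 * K) * N ^ 3 + + 3 * (H + K - + 1) * N ^ 2 - K * N
closed-form-ℤ U T D N H K split lines diagonals = begin
    + 6 * U
  ≡⟨ solve 5 (λ U T N H K → con (+ 6) :* U
       := con (+ 3) :* (con (+ 2) :* U :+ T) :- con (+ 3) :* (T :+ (H :+ K) :* N :^ 2) :+ con (+ 3) :* (H :+ K) :* N :^ 2)
       refl U T N H K ⟩
    + 3 * (+ 2 * U + T) - + 3 * (T + (H + K) * N ^ 2) + + 3 * (H + K) * N ^ 2
  ≡⟨ cong₂ (λ x y → + 3 * x - + 3 * y + + 3 * (H + K) * N ^ 2) split lines ⟩
    + 3 * N ^ 4 - + 3 * (H * N ^ 3 + K * D + N ^ 2) + + 3 * (H + K) * N ^ 2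
  ≡⟨ solve 4 (λ N H K D →
         con (+ 3) :* N :^ 4 :- con (+ 3) :* (H :* N :^ 3 :+ K :* D :+ N :^ 2) :+ con (+ 3) :* (H :+ K) :* N :^ 2
       := con (+ 3) :* N :^ 4 :- con (+ 3) :* H :* N :^ 3 :- K :* (con (+ 3) :* D) :+ con (+ 3) :* (H :+ K :- con (+ 1)) :* N :^ 2)
       refl N H K D ⟩
    + 3 * N ^ 4 - + 3 * H * N ^ 3 - K * (+ 3 * D) + + 3 * (H + K - + 1) * N ^ 2
  ≡⟨ cong (λ x → + 3 * N ^ 4 - + 3 * H * N ^ 3 - K * x + + 3 * (H + K - + 1) * N ^ 2) diagonals ⟩
    + 3 * N ^ 4 - + 3 * H * N ^ 3 - K * (+ 2 * N ^ 3 + N) + + 3 * (H + K - + 1) * N ^ 2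
  ≡⟨ solve 3 (λ N H K →
         con (+ 3) :* N :^ 4 :- con (+ 3) :* H :* N :^ 3 :- K :* (con (+ 2) :* N :^ 3 :+ N) :+ con (+ 3) :* (H :+ K :- con (+ 1)) :* N :^ 2
       := con (+ 3) :* N :^ 4 :- (con (+ 3) :* H :+ con (+ 2) :* K) :* N :^ 3 :+ con (+ 3) :* (H :+ K :- con (+ 1)) :* N :^ 2 :- K :* N)
       refl N H K ⟩
    + 3 * N ^ 4 - (+ 3 * H + + 2 * K) * N ^ 3 + + 3 * (H + K - + 1) * N ^ 2 - K * N ∎

pos-^ : ∀ m k → + (m ℕ.^ k) ≡ (+ m) ^ k
pos-^ m ℕ.zero    = refl
pos-^ m (ℕ.suc k) = trans (ℤP.pos-* m (m ℕ.^ k)) (cong (λ x → + m * x) (pos-^ m k))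

closed-form : ∀ u t d n h k →
  2 ℕ.* u ℕ.+ t ≡ n ℕ.^ 4 →
  t ℕ.+ (h ℕ.+ k) ℕ.* n ℕ.^ 2 ≡ h ℕ.* n ℕ.^ 3 ℕ.+ k ℕ.* d ℕ.+ n ℕ.^ 2 →
  3 ℕ.* d ≡ 2 ℕ.* n ℕ.^ 3 ℕ.+ n →
  + 6 * + u ≡ + 3 * (+ n) ^ 4 - (+ 3 * + h + + 2 * + k) * (+ n) ^ 3
              + + 3 * (+ h + + k - + 1) * (+ n) ^ 2 - + k * + n
closed-form u t d n h k split lines diagonals =
  closed-form-ℤ (+ u) (+ t) (+ d) (+ n) (+ h) (+ k) split-ℤ lines-ℤ diagonals-ℤ
  where
  split-ℤ : + 2 * + u + + t ≡ (+ n) ^ 4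
  split-ℤ = trans (cong (λ x → x + + t) (sym (ℤP.pos-* 2 u))) (trans (cong +_ split) (pos-^ n 4))
  lines-ℤ : + t + (+ h + + k) * (+ n) ^ 2 ≡ + h * (+ n) ^ 3 + + k * + d + (+ n) ^ 2
  lines-ℤ = begin
      + t + (+ h + + k) * (+ n) ^ 2
    ≡⟨ cong (λ x → + t + (+ h + + k) * x) (sym (pos-^ n 2)) ⟩
      + t + + (h ℕ.+ k) * + (n ℕ.^ 2)
    ≡⟨ cong (λ x → + t + x) (sym (ℤP.pos-* (h ℕ.+ k) (n ℕ.^ 2))) ⟩
      + (t ℕ.+ (h ℕ.+ k) ℕ.* n ℕ.^ 2)
    ≡⟨ cong +_ lines ⟩
      + (h ℕ.* n ℕ.^ 3) + + (k ℕ.* d) + + (n ℕ.^ 2)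
    ≡⟨ cong₂ _+_ (cong₂ _+_ (trans (ℤP.pos-* h (n ℕ.^ 3)) (cong (λ x → + h * x) (pos-^ n 3))) (ℤP.pos-* k d)) (pos-^ n 2) ⟩
      + h * (+ n) ^ 3 + + k * + d + (+ n) ^ 2 ∎
  diagonals-ℤ : + 3 * + d ≡ + 2 * (+ n) ^ 3 + + n
  diagonals-ℤ = trans (sym (ℤP.pos-* 3 d))
    (trans (cong +_ diagonals) (cong (λ x → x + + n) (trans (ℤP.pos-* 2 (n ℕ.^ 3)) (cong (λ x → + 2 * x) (pos-^ n 3)))))

-- Theorem 4.1: the three counting identities, read in ℤ.
theorem4p1 : (P : Piece) → 1 ≤ hOf P ℕ.+ kOf P → (n : ℕ) → 1 ≤ n →
    + 6 * + (u2 P n)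
      ≡ + 3 * (+ n) ^ 4 - (+ 3 * + hOf P + + 2 * + kOf P) * (+ n) ^ 3
        + + 3 * (+ hOf P + + kOf P - + 1) * (+ n) ^ 2 - + kOf P * + n
theorem4p1 P hyp n _ =
  closed-form (u2 P n) (attackingPairs P n) (diagonalPairs n) n (hOf P) (kOf P)
    (nonattacking-pairs P n moves) (attacking-pairs P n moves) (diagonal-pairs n)
  where
  moves : anyFlag P ≡ true
  moves = some-move P hyp
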